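{- Let $n$ be a positive integer and let $x_1,\ldots,x_n,t,v$ be independent indeterminates. Then, as an identity of rational functions, $$ x_1\cdots x_n \sum_{k=1}^n x_k^{ -1}(1-tx_k)(1-vx_k) \prod_{\substack{i=1\\ i\neq k}}^n \frac{1-x_ix_k}{x_i-x_k} = \begin{cases} (1-t\,x_1\cdots x_n)(1-v\,x_1\cdots x_n), & \text{if } n \text{ is odd},\\ (1-x_1\cdots x_n)(1-tv\,x_1\cdots x_n), & \text{if } n \text{ is even}.\end{cases}$$ -}

module Defs where

open import Data.Nat using (ℕ; zero; suc)
open import Data.Fin using (Fin; zero; suc; _≟_)
open import Data.Rational using (ℚ; 0ℚ; 1ℚ; _*_; _+_; _÷_; ≢-nonZero)
open import Relation.Binary.PropositionalEquality using (_≢_; _≡_)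
open import Relation.Nullary using (Dec; yes; no)

∏ : ∀ {n} → (Fin n → ℚ) → ℚ
∏ {zero} f = 1ℚ
∏ {suc n} f = f zero * ∏ (λ i → f (suc i))

∑ : ∀ {n} → (Fin n → ℚ) → ℚ
∑ {zero} f = 0ℚ
∑ {suc n} f = f zero + ∑ (λ i → f (suc i))

∏≠ : ∀ {n} (k : Fin n) → ((i : Fin n) → i ≢ k → ℚ) → ℚ
∏≠ {n} k f = ∏ (λ i → g i (i ≟ k))
  where
  g : (i : Fin n) → Dec (i ≡ k) → ℚ
  g i (yes _) = 1ℚ
  g i (no p) = f i p

div : (p q : ℚ) → q ≢ 0ℚ → ℚ
div p q h = _÷_ p q {{≢-nonZero h}}

-- Let T_k = ∏_{i≠k} (1 - x_i x_k)/(x_i - x_k) and K(z) = ∏_i (1 - x_i z)/(x_i - z)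
-- (weight x k and kernel x z below).
-- K has simple poles at the x_k with residues -(1 - x_k²) T_k and is bounded at
-- infinity, so K(z) - (1 - z²) ∑_k T_k/(x_k - z) is a polynomial of degree ≤ 1;
-- its values K(1) = (-1)^n and K(-1) = 1 give the partial fraction expansion
--   K(z) = (1 - z²) ∑_k T_k/(x_k - z) + ε (1 + z) - z,
-- where ε = evenIndicator n is 1 if n is even and 0 if n is odd.
-- At z = 0 it gives ∑_k T_k/x_k = 1/(x_1⋯x_n) - ε, and together with the moments
-- ∑_k T_k = 1 - ε and ∑_k x_k T_k = x_1⋯x_n - ε, the expansion
-- x⁻¹(1 - t x)(1 - v x) = x⁻¹ - (t + v) + t v x yields both cases of the theorem.
-- All three identities are proved by induction on n: T_1 is K(x_1) formed with
-- the remaining points, and every other T_k gains the factor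
-- (1 - x_1 x_k)/(x_1 - x_k), which is split into partial fractions in x_k.

module Submission where

open import Defs
open import Level using (0ℓ)
open import Data.Nat using (ℕ; zero; suc; _%_; _≤_)
open import Data.Fin using (Fin; zero; suc)
open import Data.Fin.Properties using (_≟_; suc-injective)
open import Data.Product using (_×_; _,_)
open import Data.Rational using (ℚ; 0ℚ; 1ℚ; _*_; _+_; _-_; -_; 1/_; ≢-nonZero)
open import Data.Rational.Properties
  using (+-*-commutativeRing; +-identityʳ; *-identityˡ; *-inverseʳ; *-assoc)
  renaming (_≟_ to _≟ℚ_)
open import Function using (_∘_)
open import Relation.Binary.PropositionalEquality
open import Relation.Nullary using (yes; no)
open import Relation.Nullary.Decidable using (dec⇒maybe)
open import Data.Empty using (⊥-elim)
open import Tactic.RingSolver using (solve-∀)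
open import Tactic.RingSolver.Core.AlmostCommutativeRing
  using (AlmostCommutativeRing; fromCommutativeRing)
open import Algebra.Bundles using (CommutativeRing)
open import Algebra.Properties.Semiring.Sum (CommutativeRing.semiring +-*-commutativeRing)
  using (sum; sum-cong-≗; ∑-distrib-+; *-distribˡ-sum)
open ≡-Reasoning

ℚ-ring : AlmostCommutativeRing 0ℓ 0ℓ
ℚ-ring = fromCommutativeRing +-*-commutativeRing (λ q → dec⇒maybe (0ℚ ≟ℚ q))

infix 9 _⁻¹

-- A total inverse with 0ℚ ⁻¹ = 0ℚ; it is only ever applied to nonzero numbers.
_⁻¹ : ℚ → ℚ
q ⁻¹ with q ≟ℚ 0ℚ
... | yes _ = 0ℚ
... | no q≢0 = 1/_ q {{≢-nonZero q≢0}}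

⁻¹-inverseʳ : ∀ {q} → q ≢ 0ℚ → q * q ⁻¹ ≡ 1ℚ
⁻¹-inverseʳ {q} q≢0 with q ≟ℚ 0ℚ
... | yes q≡0 = ⊥-elim (q≢0 q≡0)
... | no q≢0′ = *-inverseʳ q {{≢-nonZero q≢0′}}

div≡*⁻¹ : ∀ p q (q≢0 : q ≢ 0ℚ) → div p q q≢0 ≡ p * q ⁻¹
div≡*⁻¹ p q q≢0 with q ≟ℚ 0ℚ
... | yes q≡0 = ⊥-elim (q≢0 q≡0)
... | no _ = refl

-- Field identities are proved by the ring solver with each q ⁻¹ a fresh
-- variable, up to multiples of q * q ⁻¹ - 1ℚ that this lemma then discards.
r+[a-1]*c≡r : ∀ {a} → a ≡ 1ℚ → ∀ {r c} → r + (a - 1ℚ) * c ≡ r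
r+[a-1]*c≡r refl {r} {c} = identity r c
  where
  identity : ∀ r c → r + (1ℚ - 1ℚ) * c ≡ r
  identity = solve-∀ ℚ-ring

∑≡sum : ∀ {n} (f : Fin n → ℚ) → ∑ f ≡ sum f
∑≡sum {zero} f = refl
∑≡sum {suc n} f = cong (f zero +_) (∑≡sum (f ∘ suc))

∏-cong : ∀ {n} {f g : Fin n → ℚ} → (∀ i → f i ≡ g i) → ∏ f ≡ ∏ g
∏-cong {zero} f≗g = refl
∏-cong {suc n} f≗g = cong₂ _*_ (f≗g zero) (∏-cong (f≗g ∘ suc))

∏-*-inverse : ∀ {n} (f g : Fin n → ℚ) → (∀ i → f i * g i ≡ 1ℚ) → ∏ f * ∏ g ≡ 1ℚ
∏-*-inverse {zero} f g fg≡1 = refl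
∏-*-inverse {suc n} f g fg≡1 = begin
    (f zero * ∏ (f ∘ suc)) * (g zero * ∏ (g ∘ suc))
  ≡⟨ interchange (f zero) (∏ (f ∘ suc)) (g zero) (∏ (g ∘ suc)) ⟩
    (f zero * g zero) * (∏ (f ∘ suc) * ∏ (g ∘ suc))
  ≡⟨ cong₂ _*_ (fg≡1 zero) (∏-*-inverse (f ∘ suc) (g ∘ suc) (fg≡1 ∘ suc)) ⟩
    1ℚ * 1ℚ
  ∎
  where
  interchange : ∀ a b c d → (a * b) * (c * d) ≡ (a * c) * (b * d)
  interchange = solve-∀ ℚ-ring

-- The factors of ∏≠ go through a selector private to Defs, so the
-- pointwise statements below cannot be written down; their types are
-- solved from their single use (hence the mutual blocks).
mutual
  ∏≠-cong : ∀ {n} (k : Fin n) {f g : (i : Fin n) → i ≢ k → ℚ} →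
            (∀ i i≢k → f i i≢k ≡ g i i≢k) → ∏≠ k f ≡ ∏≠ k g
  ∏≠-cong k f≗g = ∏-cong (∏≠-cong-factors k f≗g)

  ∏≠-cong-factors : ∀ {n} (k : Fin n) {f g : (i : Fin n) → i ≢ k → ℚ} →
                    (∀ i i≢k → f i i≢k ≡ g i i≢k) → ∀ i → _
  ∏≠-cong-factors k f≗g i with i ≟ k
  ... | yes _ = refl
  ... | no i≢k = f≗g i i≢k

∏≠-zero : ∀ {n} (h : Fin (suc n) → ℚ) → ∏≠ zero (λ i _ → h i) ≡ ∏ (h ∘ suc)
∏≠-zero h = *-identityˡ _

mutual
  ∏≠-suc : ∀ {n} (k : Fin n) (h : Fin (suc n) → ℚ) →
           ∏≠ (suc k) (λ i _ → h i) ≡ h zero * ∏≠ k (λ i _ → h (suc i))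
  ∏≠-suc k h = cong (h zero *_) (∏-cong (∏≠-suc-factors k h))

  ∏≠-suc-factors : ∀ {n} (k : Fin n) (h : Fin (suc n) → ℚ) → ∀ i → _
  ∏≠-suc-factors k h i with i ≟ k
  ... | yes _ = refl
  ... | no _ = refl

factor : ℚ → ℚ → ℚ
factor a z = (1ℚ - a * z) * (a - z) ⁻¹

kernel : ∀ {n} → (Fin n → ℚ) → ℚ → ℚ
kernel x z = ∏ (λ i → factor (x i) z)

weight : ∀ {n} → (Fin n → ℚ) → Fin n → ℚ
weight x k = ∏≠ k (λ i _ → factor (x i) (x k))

weightedSum : ∀ {n} → (Fin n → ℚ) → (ℚ → ℚ) → ℚ
weightedSum x f = sum (λ k → f (x k) * weight x k)

Distinct : ∀ {n} → (Fin n → ℚ) → Set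
Distinct x = ∀ i k → i ≢ k → x i - x k ≢ 0ℚ

Distinct-tail : ∀ {n} {x : Fin (suc n) → ℚ} → Distinct x → Distinct (x ∘ suc)
Distinct-tail x-distinct i k i≢k = x-distinct (suc i) (suc k) (i≢k ∘ suc-injective)

evenIndicator : ℕ → ℚ
evenIndicator zero = 1ℚ
evenIndicator (suc n) = 1ℚ - evenIndicator n

1-[1-p]≡p : ∀ p → 1ℚ - (1ℚ - p) ≡ p
1-[1-p]≡p = solve-∀ ℚ-ring

evenIndicator-even : ∀ n → n % 2 ≡ 0 → evenIndicator n ≡ 1ℚ
evenIndicator-even zero _ = refl
evenIndicator-even (suc (suc n)) n-even = trans (1-[1-p]≡p _) (evenIndicator-even n n-even)

evenIndicator-odd : ∀ n → n % 2 ≡ 1 → evenIndicator n ≡ 0ℚ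
evenIndicator-odd (suc zero) _ = refl
evenIndicator-odd (suc (suc n)) n-odd = trans (1-[1-p]≡p _) (evenIndicator-odd n n-odd)

module _ {n} (x : Fin (suc n) → ℚ) where

  weight-zero : weight x zero ≡ kernel (x ∘ suc) (x zero)
  weight-zero = ∏≠-zero (λ i → factor (x i) (x zero))

  weight-suc : ∀ k → weight x (suc k) ≡ factor (x zero) (x (suc k)) * weight (x ∘ suc) k
  weight-suc k = ∏≠-suc k (λ i → factor (x i) (x (suc k)))

  weightedSum-suc : ∀ f → weightedSum x f ≡
    f (x zero) * kernel (x ∘ suc) (x zero) + weightedSum (x ∘ suc) (λ u → f u * factor (x zero) u)
  weightedSum-suc f = begin
    f y * weight x zero + sum (λ k → f (x (suc k)) * weight x (suc k))
      ≡⟨ cong₂ _+_ (cong (f y *_) weight-zero) (sum-cong-≗ tail) ⟩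
    f y * kernel (x ∘ suc) y + sum (λ k → f (x (suc k)) * factor y (x (suc k)) * weight (x ∘ suc) k) ∎
    where
    y : ℚ
    y = x zero
    tail : ∀ k → f (x (suc k)) * weight x (suc k) ≡ f (x (suc k)) * factor y (x (suc k)) * weight (x ∘ suc) k
    tail k = trans (cong (f (x (suc k)) *_) (weight-suc k)) (sym (*-assoc (f (x (suc k))) _ _))

module _ {n} (x : Fin n → ℚ) where

  weightedSum-cong : ∀ f g → (∀ k → f (x k) ≡ g (x k)) → weightedSum x f ≡ weightedSum x g
  weightedSum-cong f g f≗g = sum-cong-≗ (λ k → cong (_* weight x k) (f≗g k))

  weightedSum-linear₂ : ∀ f g h a b → (∀ k → f (x k) ≡ a * g (x k) + b * h (x k)) →
                        weightedSum x f ≡ a * weightedSum x g + b * weightedSum x h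
  weightedSum-linear₂ f g h a b f≗ag+bh = begin
      weightedSum x f
    ≡⟨ weightedSum-cong f (λ u → a * g u + b * h u) f≗ag+bh ⟩
      sum (λ k → (a * g (x k) + b * h (x k)) * weight x k)
    ≡⟨ sum-cong-≗ (λ k → distrib a b (g (x k)) (h (x k)) (weight x k)) ⟩
      sum (λ k → a * G k + b * H k)
    ≡⟨ ∑-distrib-+ (λ k → a * G k) (λ k → b * H k) ⟩
      sum (λ k → a * G k) + sum (λ k → b * H k)
    ≡⟨ cong₂ _+_ (*-distribˡ-sum a G) (*-distribˡ-sum b H) ⟨
      a * sum G + b * sum H
    ∎
    where
    G H : Fin n → ℚ
    G k = g (x k) * weight x k
    H k = h (x k) * weight x k
    distrib : ∀ a b u v w → (a * u + b * v) * w ≡ a * (u * w) + b * (v * w)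
    distrib = solve-∀ ℚ-ring

  weightedSum-linear₃ : ∀ f g h l a b c → (∀ k → f (x k) ≡ a * g (x k) + b * h (x k) + c * l (x k)) →
                        weightedSum x f ≡ a * weightedSum x g + b * weightedSum x h + c * weightedSum x l
  weightedSum-linear₃ f g h l a b c f≗ag+bh+cl = begin
    weightedSum x f
      ≡⟨ weightedSum-linear₂ f (λ u → a * g u + b * h u) l 1ℚ c
           (λ k → trans (f≗ag+bh+cl k) (cong (_+ c * l (x k)) (sym (*-identityˡ (a * g (x k) + b * h (x k)))))) ⟩
    1ℚ * weightedSum x (λ u → a * g u + b * h u) + c * weightedSum x l
      ≡⟨ cong (_+ c * weightedSum x l)
              (trans (*-identityˡ _) (weightedSum-linear₂ (λ u → a * g u + b * h u) g h a b (λ _ → refl))) ⟩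
    a * weightedSum x g + b * weightedSum x h + c * weightedSum x l
      ∎

factor-partialFraction : ∀ {y u z} → y - u ≢ 0ℚ → u - z ≢ 0ℚ → y - z ≢ 0ℚ → u - y ≢ 0ℚ →
  (u - z) ⁻¹ * factor y u ≡ factor y z * (u - z) ⁻¹ + (- ((1ℚ - y * y) * (y - z) ⁻¹)) * (u - y) ⁻¹
factor-partialFraction {y} {u} {z} y-u≢0 u-z≢0 y-z≢0 u-y≢0 =
  trans (certificate y u z ((y - u) ⁻¹) ((u - z) ⁻¹) ((y - z) ⁻¹) ((u - y) ⁻¹))
  (trans (r+[a-1]*c≡r (⁻¹-inverseʳ u-y≢0))
  (trans (r+[a-1]*c≡r (⁻¹-inverseʳ y-z≢0))
  (trans (r+[a-1]*c≡r (⁻¹-inverseʳ u-z≢0))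
         (r+[a-1]*c≡r (⁻¹-inverseʳ y-u≢0)))))
  where
  certificate : ∀ y u z a b c d →
    b * ((1ℚ - y * u) * a) ≡ ((1ℚ - y * z) * c) * b + (- ((1ℚ - y * y) * c)) * d
      + ((y - u) * a - 1ℚ) * ((1ℚ - y * y) * b * c + y * b - (1ℚ - y * y) * c * d)
      + ((u - z) * b - 1ℚ) * ((1ℚ - y * y) * a * c)
      + ((y - z) * c - 1ℚ) * (- ((1ℚ - y * y) * a * b) - y * b)
      + ((u - y) * d - 1ℚ) * (- ((1ℚ - y * y) * a * c))
  certificate = solve-∀ ℚ-ring

module HeadTail {n} (x : Fin (suc n) → ℚ) (x-distinct : Distinct x) where

  y : ℚ
  y = x zero

  x′ : Fin n → ℚ
  x′ = x ∘ suc

  x′-distinct : Distinct x′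
  x′-distinct = Distinct-tail {x = x} x-distinct

  y≢x′ : ∀ k → y - x′ k ≢ 0ℚ
  y≢x′ k = x-distinct zero (suc k) λ ()

  x′≢y : ∀ k → x′ k - y ≢ 0ℚ
  x′≢y k = x-distinct (suc k) zero λ ()

  e : ℚ
  e = evenIndicator n

  W′ : ℚ → ℚ
  W′ z = weightedSum x′ (λ u → (u - z) ⁻¹)

kernel-partialFractions : ∀ {n} (x : Fin n → ℚ) → Distinct x → ∀ z → (∀ i → x i - z ≢ 0ℚ) →
  kernel x z ≡ (1ℚ - z * z) * weightedSum x (λ u → (u - z) ⁻¹) + evenIndicator n * (1ℚ + z) - z
kernel-partialFractions {zero} x _ z _ = empty z
  where
  empty : ∀ z → 1ℚ ≡ (1ℚ - z * z) * 0ℚ + 1ℚ * (1ℚ + z) - z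
  empty = solve-∀ ℚ-ring
kernel-partialFractions {suc n} x x-distinct z x≢z = begin
    factor y z * kernel x′ z
  ≡⟨ cong (factor y z *_) (kernel-partialFractions x′ x′-distinct z (x≢z ∘ suc)) ⟩
    factor y z * ((1ℚ - z * z) * W′ z + e * (1ℚ + z) - z)
  ≡⟨ trans (certificate y z e (W′ z) ((y - z) ⁻¹)) (r+[a-1]*c≡r (⁻¹-inverseʳ (x≢z zero))) ⟩
    (1ℚ - z * z) * (factor y z * W′ z + (y - z) ⁻¹ * (e * (1ℚ + y) - y)) + (1ℚ - e) * (1ℚ + z) - z
  ≡⟨ cong (λ S → (1ℚ - z * z) * S + (1ℚ - e) * (1ℚ + z) - z) weightedSum-tail ⟨
    (1ℚ - z * z) * weightedSum x (λ u → (u - z) ⁻¹) + (1ℚ - e) * (1ℚ + z) - z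
  ∎
  where
  open HeadTail x x-distinct

  weightedSum-tail : weightedSum x (λ u → (u - z) ⁻¹) ≡ factor y z * W′ z + (y - z) ⁻¹ * (e * (1ℚ + y) - y)
  weightedSum-tail = begin
      weightedSum x (λ u → (u - z) ⁻¹)
    ≡⟨ weightedSum-suc x (λ u → (u - z) ⁻¹) ⟩
      (y - z) ⁻¹ * kernel x′ y + weightedSum x′ (λ u → (u - z) ⁻¹ * factor y u)
    ≡⟨ cong₂ _+_
         (cong ((y - z) ⁻¹ *_) (kernel-partialFractions x′ x′-distinct y x′≢y))
         (weightedSum-linear₂ x′ (λ u → (u - z) ⁻¹ * factor y u) (λ u → (u - z) ⁻¹) (λ u → (u - y) ⁻¹)
                                 (factor y z) (- ((1ℚ - y * y) * (y - z) ⁻¹)) λ k →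
            factor-partialFraction {y} {x′ k} {z} (y≢x′ k) (x≢z (suc k)) (x≢z zero) (x′≢y k)) ⟩
      (y - z) ⁻¹ * ((1ℚ - y * y) * W′ y + e * (1ℚ + y) - y)
        + (factor y z * W′ z + (- ((1ℚ - y * y) * (y - z) ⁻¹)) * W′ y)
    ≡⟨ cancel ((y - z) ⁻¹) y (W′ y) e (factor y z) (W′ z) ⟩
      factor y z * W′ z + (y - z) ⁻¹ * (e * (1ℚ + y) - y)
    ∎
    where
    cancel : ∀ c y V e F W → c * ((1ℚ - y * y) * V + e * (1ℚ + y) - y) + (F * W + (- ((1ℚ - y * y) * c)) * V)
                             ≡ F * W + c * (e * (1ℚ + y) - y)
    cancel = solve-∀ ℚ-ring

  certificate : ∀ y z e W c →
    ((1ℚ - y * z) * c) * ((1ℚ - z * z) * W + e * (1ℚ + z) - z)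
      ≡ (1ℚ - z * z) * (((1ℚ - y * z) * c) * W + c * (e * (1ℚ + y) - y)) + (1ℚ - e) * (1ℚ + z) - z
        + ((y - z) * c - 1ℚ) * (1ℚ - e * (1ℚ + z))
  certificate = solve-∀ ℚ-ring

weightedSum-one : ∀ {n} (x : Fin n → ℚ) → Distinct x → weightedSum x (λ _ → 1ℚ) ≡ 1ℚ - evenIndicator n
weightedSum-one {zero} x _ = refl
weightedSum-one {suc n} x x-distinct = begin
    weightedSum x (λ _ → 1ℚ)
  ≡⟨ weightedSum-suc x (λ _ → 1ℚ) ⟩
    1ℚ * kernel x′ y + weightedSum x′ (λ u → 1ℚ * factor y u)
  ≡⟨ cong₂ _+_ (cong (1ℚ *_) (kernel-partialFractions x′ x′-distinct y x′≢y))
       (trans (weightedSum-linear₂ x′ (λ u → 1ℚ * factor y u) (λ _ → 1ℚ) (λ u → (u - y) ⁻¹)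
                                   y (- (1ℚ - y * y)) expansion)
              (cong (λ S → y * S + (- (1ℚ - y * y)) * W′ y) (weightedSum-one x′ x′-distinct))) ⟩
    1ℚ * ((1ℚ - y * y) * W′ y + e * (1ℚ + y) - y) + (y * (1ℚ - e) + (- (1ℚ - y * y)) * W′ y)
  ≡⟨ algebra y e (W′ y) ⟩
    1ℚ - (1ℚ - e)
  ∎
  where
  open HeadTail x x-distinct
  expansion : ∀ k → 1ℚ * factor y (x′ k) ≡ y * 1ℚ + (- (1ℚ - y * y)) * (x′ k - y) ⁻¹
  expansion k = trans (certificate y (x′ k) ((y - x′ k) ⁻¹) ((x′ k - y) ⁻¹))
                (trans (r+[a-1]*c≡r (⁻¹-inverseʳ (x′≢y k)))
                       (r+[a-1]*c≡r (⁻¹-inverseʳ (y≢x′ k))))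
    where
    certificate : ∀ y u a b →
      1ℚ * ((1ℚ - y * u) * a) ≡ y * 1ℚ + (- (1ℚ - y * y)) * b
        + ((y - u) * a - 1ℚ) * (y - (1ℚ - y * y) * b)
        + ((u - y) * b - 1ℚ) * (- ((1ℚ - y * y) * a))
    certificate = solve-∀ ℚ-ring
  algebra : ∀ y e V → 1ℚ * ((1ℚ - y * y) * V + e * (1ℚ + y) - y) + (y * (1ℚ - e) + (- (1ℚ - y * y)) * V)
                      ≡ 1ℚ - (1ℚ - e)
  algebra = solve-∀ ℚ-ring

weightedSum-id : ∀ {n} (x : Fin n → ℚ) → Distinct x → weightedSum x (λ u → u) ≡ ∏ x - evenIndicator n
weightedSum-id {zero} x _ = refl
weightedSum-id {suc n} x x-distinct = begin
    weightedSum x (λ u → u)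
  ≡⟨ weightedSum-suc x (λ u → u) ⟩
    y * kernel x′ y + weightedSum x′ (λ u → u * factor y u)
  ≡⟨ cong₂ _+_ (cong (y *_) (kernel-partialFractions x′ x′-distinct y x′≢y))
       (trans (weightedSum-linear₃ x′ (λ u → u * factor y u) (λ u → u) (λ _ → 1ℚ) (λ u → (u - y) ⁻¹)
                                   y (- (1ℚ - y * y)) (- ((1ℚ - y * y) * y)) expansion)
              (cong₂ (λ A B → y * A + (- (1ℚ - y * y)) * B + (- ((1ℚ - y * y) * y)) * W′ y)
                     (weightedSum-id x′ x′-distinct) (weightedSum-one x′ x′-distinct))) ⟩
    y * ((1ℚ - y * y) * W′ y + e * (1ℚ + y) - y)
      + (y * (∏ x′ - e) + (- (1ℚ - y * y)) * (1ℚ - e) + (- ((1ℚ - y * y) * y)) * W′ y)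
  ≡⟨ algebra y e (W′ y) (∏ x′) ⟩
    y * ∏ x′ - (1ℚ - e)
  ∎
  where
  open HeadTail x x-distinct
  expansion : ∀ k → x′ k * factor y (x′ k)
                    ≡ y * x′ k + (- (1ℚ - y * y)) * 1ℚ + (- ((1ℚ - y * y) * y)) * (x′ k - y) ⁻¹
  expansion k = trans (certificate y (x′ k) ((y - x′ k) ⁻¹) ((x′ k - y) ⁻¹))
                (trans (r+[a-1]*c≡r (⁻¹-inverseʳ (x′≢y k)))
                       (r+[a-1]*c≡r (⁻¹-inverseʳ (y≢x′ k))))
    where
    certificate : ∀ y u a b →
      u * ((1ℚ - y * u) * a) ≡ y * u + (- (1ℚ - y * y)) * 1ℚ + (- ((1ℚ - y * y) * y)) * b
        + ((y - u) * a - 1ℚ) * (u * y + y * y - 1ℚ - (1ℚ - y * y) * y * b)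
        + ((u - y) * b - 1ℚ) * (- ((1ℚ - y * y) * y * a))
    certificate = solve-∀ ℚ-ring
  algebra : ∀ y e V P′ → y * ((1ℚ - y * y) * V + e * (1ℚ + y) - y)
                           + (y * (P′ - e) + (- (1ℚ - y * y)) * (1ℚ - e) + (- ((1ℚ - y * y) * y)) * V)
                         ≡ y * P′ - (1ℚ - e)
  algebra = solve-∀ ℚ-ring

module _ {n} (x : Fin n → ℚ) (x≢0 : ∀ i → x i ≢ 0ℚ) where

  x-0≢0 : ∀ i → x i - 0ℚ ≢ 0ℚ
  x-0≢0 i x-0≡0 = x≢0 i (trans (sym (+-identityʳ (x i))) x-0≡0)

  ∏*kernel[0]≡1 : ∏ x * kernel x 0ℚ ≡ 1ℚ
  ∏*kernel[0]≡1 = ∏-*-inverse x (λ i → factor (x i) 0ℚ) λ i →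
    trans (certificate (x i) ((x i - 0ℚ) ⁻¹)) (r+[a-1]*c≡r (⁻¹-inverseʳ (x-0≢0 i)))
    where
    certificate : ∀ u a → u * ((1ℚ - u * 0ℚ) * a) ≡ 1ℚ + ((u - 0ℚ) * a - 1ℚ) * 1ℚ
    certificate = solve-∀ ℚ-ring

  weightedSum-inverse : Distinct x → weightedSum x _⁻¹ ≡ kernel x 0ℚ - evenIndicator n
  weightedSum-inverse x-distinct = begin
      weightedSum x _⁻¹
    ≡⟨ weightedSum-cong x _⁻¹ (λ u → (u - 0ℚ) ⁻¹) (λ k → cong _⁻¹ (sym (+-identityʳ (x k)))) ⟩
      W₀
    ≡⟨ algebra W₀ (evenIndicator n) ⟩
      (1ℚ - 0ℚ * 0ℚ) * W₀ + evenIndicator n * (1ℚ + 0ℚ) - 0ℚ - evenIndicator n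
    ≡⟨ cong (_- evenIndicator n) (kernel-partialFractions x x-distinct 0ℚ x-0≢0) ⟨
      kernel x 0ℚ - evenIndicator n
    ∎
    where
    W₀ : ℚ
    W₀ = weightedSum x (λ u → (u - 0ℚ) ⁻¹)
    algebra : ∀ W e → W ≡ (1ℚ - 0ℚ * 0ℚ) * W + e * (1ℚ + 0ℚ) - 0ℚ - e
    algebra = solve-∀ ℚ-ring

∏*∑≡closedForm : ∀ {n} (x : Fin n → ℚ) (x≢0 : ∀ k → x k ≢ 0ℚ) (x-distinct : Distinct x) (t v : ℚ) →
  ∏ x * ∑ (λ k → div 1ℚ (x k) (x≢0 k) * (1ℚ - t * x k) * (1ℚ - v * x k)
                 * ∏≠ k (λ i i≢k → div (1ℚ - x i * x k) (x i - x k) (x-distinct i k i≢k)))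
    ≡ 1ℚ - evenIndicator n * (1ℚ + t * v) * ∏ x - (1ℚ - evenIndicator n) * (t + v) * ∏ x + t * v * (∏ x * ∏ x)
∏*∑≡closedForm {n} x x≢0 x-distinct t v = begin
    P * ∑ summand
  ≡⟨ cong (P *_) (trans (∑≡sum summand) (sum-cong-≗ summand≡)) ⟩
    P * weightedSum x f
  ≡⟨ cong (P *_) (weightedSum-linear₃ x f _⁻¹ (λ _ → 1ℚ) (λ u → u) 1ℚ (- (t + v)) (t * v) expansion) ⟩
    P * (1ℚ * weightedSum x _⁻¹ + (- (t + v)) * weightedSum x (λ _ → 1ℚ) + (t * v) * weightedSum x (λ u → u))
  ≡⟨ cong (λ A → P * (1ℚ * A + (- (t + v)) * weightedSum x (λ _ → 1ℚ) + (t * v) * weightedSum x (λ u → u)))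
          (weightedSum-inverse x x≢0 x-distinct) ⟩
    P * (1ℚ * (K₀ - e) + (- (t + v)) * weightedSum x (λ _ → 1ℚ) + (t * v) * weightedSum x (λ u → u))
  ≡⟨ cong₂ (λ B C → P * (1ℚ * (K₀ - e) + (- (t + v)) * B + (t * v) * C))
           (weightedSum-one x x-distinct) (weightedSum-id x x-distinct) ⟩
    P * (1ℚ * (K₀ - e) + (- (t + v)) * (1ℚ - e) + (t * v) * (P - e))
  ≡⟨ trans (collect P K₀ e t v) (r+[a-1]*c≡r (∏*kernel[0]≡1 x x≢0)) ⟩
    1ℚ - e * (1ℚ + t * v) * P - (1ℚ - e) * (t + v) * P + t * v * (P * P)
  ∎
  where
  P K₀ e : ℚ
  P = ∏ x
  K₀ = kernel x 0ℚ
  e = evenIndicator n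
  f : ℚ → ℚ
  f u = 1ℚ * u ⁻¹ * (1ℚ - t * u) * (1ℚ - v * u)
  summand : Fin n → ℚ
  summand k = div 1ℚ (x k) (x≢0 k) * (1ℚ - t * x k) * (1ℚ - v * x k)
              * ∏≠ k (λ i i≢k → div (1ℚ - x i * x k) (x i - x k) (x-distinct i k i≢k))
  summand≡ : ∀ k → summand k ≡ f (x k) * weight x k
  summand≡ k = cong₂ (λ a b → a * (1ℚ - t * x k) * (1ℚ - v * x k) * b)
                     (div≡*⁻¹ 1ℚ (x k) (x≢0 k))
                     (∏≠-cong k λ i i≢k → div≡*⁻¹ (1ℚ - x i * x k) (x i - x k) (x-distinct i k i≢k))
  expansion : ∀ k → f (x k) ≡ 1ℚ * x k ⁻¹ + (- (t + v)) * 1ℚ + (t * v) * x k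
  expansion k = trans (certificate t v (x k) (x k ⁻¹)) (r+[a-1]*c≡r (⁻¹-inverseʳ (x≢0 k)))
    where
    certificate : ∀ t v u a → 1ℚ * a * (1ℚ - t * u) * (1ℚ - v * u)
                           ≡ 1ℚ * a + (- (t + v)) * 1ℚ + (t * v) * u + (u * a - 1ℚ) * (t * v * u - (t + v))
    certificate = solve-∀ ℚ-ring
  collect : ∀ P K e t v →
    P * (1ℚ * (K - e) + (- (t + v)) * (1ℚ - e) + (t * v) * (P - e))
      ≡ 1ℚ - e * (1ℚ + t * v) * P - (1ℚ - e) * (t + v) * P + t * v * (P * P) + (P * K - 1ℚ) * 1ℚ
  collect = solve-∀ ℚ-ring

lemma1 : (n : ℕ) → 1 ≤ n → (x : Fin n → ℚ) → (t v : ℚ)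
    → (x≢0 : (k : Fin n) → x k ≢ 0ℚ)
    → (dist : (i k : Fin n) → i ≢ k → x i - x k ≢ 0ℚ)
    → let P = ∏ x
          L = P * ∑ (λ k → div 1ℚ (x k) (x≢0 k) * (1ℚ - t * x k) * (1ℚ - v * x k)
                      * ∏≠ k (λ i i≢k → div (1ℚ - x i * x k) (x i - x k) (dist i k i≢k)))
      in (n % 2 ≡ 1 → L ≡ (1ℚ - t * P) * (1ℚ - v * P))
       × (n % 2 ≡ 0 → L ≡ (1ℚ - P) * (1ℚ - t * v * P))
lemma1 n _ x t v x≢0 x-distinct =
    (λ n-odd → trans (∏*∑≡closedForm x x≢0 x-distinct t v)
                     (trans (cong closedForm (evenIndicator-odd n n-odd)) (odd P t v)))
  , (λ n-even → trans (∏*∑≡closedForm x x≢0 x-distinct t v)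
                      (trans (cong closedForm (evenIndicator-even n n-even)) (even P t v)))
  where
  P : ℚ
  P = ∏ x
  closedForm : ℚ → ℚ
  closedForm e = 1ℚ - e * (1ℚ + t * v) * P - (1ℚ - e) * (t + v) * P + t * v * (P * P)
  odd : ∀ P t v → 1ℚ - 0ℚ * (1ℚ + t * v) * P - (1ℚ - 0ℚ) * (t + v) * P + t * v * (P * P)
                  ≡ (1ℚ - t * P) * (1ℚ - v * P)
  odd = solve-∀ ℚ-ring
  even : ∀ P t v → 1ℚ - 1ℚ * (1ℚ + t * v) * P - (1ℚ - 1ℚ) * (t + v) * P + t * v * (P * P)
                   ≡ (1ℚ - P) * (1ℚ - t * v * P)
  even = solve-∀ ℚ-ring
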